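{- Let $t_1, t_2 > 0$ be threshold values and let $\varphi = \bigwedge_{i=1}^n \varphi_i$ be an $\mathsf{LTLf}$ formula over a finite set of propositions $\mathsf{Prop}$, given as a conjunction of $\mathsf{LTLf}$ subformulas $\varphi_1,\dots,\varphi_n$. Then the algorithm $\mathsf{Lisa}(\varphi, t_1, t_2)$ described below terminates and returns a DFA for $\varphi$ with symbolic states, i.e. a symbolic-state DFA $(\mathcal{S},\mathcal{T},\mathcal{F})$ over alphabet $2^{\mathsf{Prop}}$ whose language equals $\mathcal{L}(\varphi)$, the set of finite words over $2^{\mathsf{Prop}}$ satisfying $\varphi$.
   Context: $\mathsf{LTLf}$ is linear temporal logic interpreted over finite traces: formulas are built by $\varphi ::= a \in \mathsf{Prop} \mid \neg\varphi \mid \varphi\wedge\varphi \mid \varphi\vee\varphi \mid \mathsf{X}\varphi \mid \varphi\,\mathsf{U}\,\varphi \mid \mathsf{F}\varphi \mid \mathsf{G}\varphi$, with the standard finite-trace semantics; $\mathcal{L}(\varphi)$ is the set of finite words over $2^{\mathsf{Prop}}$ satisfying $\varphi$. A DFA is $D=(\Sigma,S,\iota,\Delta,F)$ with $\Delta:S\times\Sigma\to S$; a word $w_0\dots w_m$ is accepted if its run $s_0=\iota$, $s_{j+1}=\Delta(s_j,w_j)$ ends in $F$. For an explicit-state DFA $D$, $|D|$ denotes its number of states; $D_1\cap D_2$ denotes the standard product DFA recognizing $\mathcal{L}(D_1)\cap\mathcal{L}(D_2)$. A symbolic-state representation of a DFA $D=(2^{\mathsf{Prop}},S,\iota,\Delta,F)$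 is a triple $(\mathcal{S}(\mathcal{Z}),\mathcal{T}(\mathcal{Z},\mathsf{Prop},\mathcal{Z}'),\mathcal{F}(\mathcal{Z}))$ of Boolean formulas (BDDs), where $\mathcal{Z}=\{z_1,\dots,z_k\}$ with $k=\lceil\log|S|\rceil$ encodes states via an injective assignment of interpretations $Z\in 2^{\mathcal{Z}}$ to states, $\mathcal{Z}'$ is a primed copy encoding next states; $\mathcal{S}$ is satisfied exactly by the encoding of $\iota$, $\mathcal{T}$ is satisfied by $(Z,P,Z')$ iff $\Delta(s,P)=s'$ for the states $s,s'$ encoded by $Z,Z'$, and $\mathcal{F}$ is satisfied by $Z$ iff the encoded state is in $F$. The language of a symbolic DFA is the language of the DFA it encodes. The symbolic intersection of $(\mathcal{S}_1,\mathcal{T}_1,\mathcal{F}_1)$ and $(\mathcal{S}_2,\mathcal{T}_2,\mathcal{F}_2)$ (whose state variable sets are disjoint) is $(\mathcal{S}_1\wedge\mathcal{S}_2,\mathcal{T}_1\wedge\mathcal{T}_2,\mathcal{F}_1\wedge\mathcal{F}_2)$, with state variables the union. Algorithm $\mathsf{Lisa}(\varphi,t_1,t_2)$: (1) Decomposition: for each $i$, construct an explicit-state minimal DFA $D_i$ with $\mathcal{L}(D_i)=\mathcal{L}(\varphi_i)$, and put all $D_i$ into a collection ordered by number of states. (2) Explicit composition: remove the two DFAs $D_1,D_2$ with fewest states (with $|D_1|\le|D_2|$). While $|D_1|<t_1$ and $|D_1|\cdot|D_2|<t_2$: form the minimal DFA equivalent to $D_1\cap D_2$ and insert it into the collection;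 if the collection now has exactly one DFA, convert it to symbolic-state representation and return it; otherwise remove the two DFAs with fewest states and repeat the test. (3) Change of representation: when the loop condition fails, convert every DFA remaining (including the two removed ones) to symbolic-state representation, each using its own fresh set of state variables disjoint from all others, and put them into a collection ordered by the number of BDD nodes of the transition relation. (4) Symbolic composition: while the collection has more than one element, remove the two with fewest transition-BDD nodes, form their symbolic intersection (without minimization), and insert it back. Return the single remaining symbolic DFA. -}

module Defs where

open import Data.Nat using (ℕ; zero; suc; _+_; _*_; _≤_; _<_)
open import Data.Nat.Logarithm using (⌈log₂_⌉)
open import Data.Bool using (Bool; true; false; _∧_)
open import Data.Fin using (Fin; fromℕ<; _↑ˡ_; _↑ʳ_)
open import Data.List using (List; []; _∷_; length; lookup)
open import Data.List.NonEmpty using (List⁺; _∷_; toList)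
open import Data.List.Relation.Unary.All using (All)
open import Data.List.Relation.Binary.Pointwise using (Pointwise)
open import Data.List.Relation.Binary.Permutation.Propositional using (_↭_)
open import Data.Product using (Σ; _×_; _,_)
open import Data.Sum using (_⊎_)
open import Data.Unit using (⊤)
open import Data.Empty using (⊥)
open import Relation.Nullary using (¬_)
open import Relation.Binary.PropositionalEquality using (_≡_; _≗_)
open import Function.Bundles using (_⇔_)

Letter : ℕ → Set
Letter p = Fin p → Bool

Word : ℕ → Set
Word p = List (Letter p)

infixr 6 _`∧_
infixr 5 _`∨_
infix 7 _`U_

data Formula (p : ℕ) : Set where
  atom  : Fin p → Formula p
  `¬_   : Formula p → Formula p
  _`∧_  : Formula p → Formula p → Formula p
  _`∨_  : Formula p → Formula p → Formula p
  `X_   : Formula p → Formula p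
  _`U_  : Formula p → Formula p → Formula p
  `F_   : Formula p → Formula p
  `G_   : Formula p → Formula p

_⊨[_]_ : ∀ {p} → Word p → ℕ → Formula p → Set
w ⊨[ i ] atom a = Σ (i < length w) λ h → lookup w (fromℕ< h) a ≡ true
w ⊨[ i ] (`¬ φ) = ¬ (w ⊨[ i ] φ)
w ⊨[ i ] (φ `∧ ψ) = (w ⊨[ i ] φ) × (w ⊨[ i ] ψ)
w ⊨[ i ] (φ `∨ ψ) = (w ⊨[ i ] φ) ⊎ (w ⊨[ i ] ψ)
w ⊨[ i ] (`X φ) = (suc i < length w) × (w ⊨[ suc i ] φ)
w ⊨[ i ] (φ `U ψ) = Σ ℕ λ j → (i ≤ j) × (j < length w) × (w ⊨[ j ] ψ)
                      × (∀ k → i ≤ k → k < j → w ⊨[ k ] φ)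
w ⊨[ i ] (`F φ) = Σ ℕ λ j → (i ≤ j) × (j < length w) × (w ⊨[ j ] φ)
w ⊨[ i ] (`G φ) = ∀ j → i ≤ j → j < length w → w ⊨[ j ] φ

Lang : ∀ {p} → Formula p → Word p → Set
Lang φ w = (0 < length w) × (w ⊨[ 0 ] φ)

conjAux : ∀ {p} → Formula p → List (Formula p) → Formula p
conjAux φ [] = φ
conjAux φ (ψ ∷ ψs) = φ `∧ conjAux ψ ψs

⋀ : ∀ {p} → List⁺ (Formula p) → Formula p
⋀ (φ ∷ φs) = conjAux φ φs

record DFA (p : ℕ) : Set where
  field
    states : ℕ
    init   : Fin states
    δ      : Fin states → Letter p → Fin states
    final  : Fin states → Bool
open DFA public

run : ∀ {p} (D : DFA p) → Fin (states D) → Word p → Fin (states D)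
run D s [] = s
run D s (a ∷ w) = run D (δ D s a) w

accepts : ∀ {p} → DFA p → Word p → Bool
accepts D w = final D (run D (init D) w)

RecognisesFormula : ∀ {p} → DFA p → Formula p → Set
RecognisesFormula D φ = ∀ w → (accepts D w ≡ true) ⇔ Lang φ w

Minimal : ∀ {p} → DFA p → Set
Minimal {p} D = ∀ (D' : DFA p) → (∀ w → accepts D' w ≡ accepts D w) → states D ≤ states D'

RecognisesIntersection : ∀ {p} → DFA p → DFA p → DFA p → Set
RecognisesIntersection D D₁ D₂ = ∀ w → accepts D w ≡ (accepts D₁ w ∧ accepts D₂ w)

-- Symbolic-state DFAs: Boolean functions S(Z), T(Z,P,Z'), F(Z)
-- over state variables Z = Fin vars (BDDs taken semantically)

Assignment : ℕ → Set
Assignment m = Fin m → Bool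

TransRel : ℕ → ℕ → Set
TransRel p m = Assignment m → Letter p → Assignment m → Bool

record SymDFA (p : ℕ) : Set where
  field
    vars  : ℕ
    S     : Assignment vars → Bool
    T     : TransRel p vars
    F     : Assignment vars → Bool
open SymDFA public

acceptsFrom : ∀ {p} (A : SymDFA p) → Assignment (vars A) → Word p → Set
acceptsFrom A Z [] = F A Z ≡ true
acceptsFrom A Z (a ∷ w) = Σ (Assignment (vars A)) λ Z' → (T A Z a Z' ≡ true) × acceptsFrom A Z' w

SymAccepts : ∀ {p} → SymDFA p → Word p → Set
SymAccepts A w = Σ (Assignment (vars A)) λ Z → (S A Z ≡ true) × acceptsFrom A Z w

record SymRep {p : ℕ} (D : DFA p) (A : SymDFA p) : Set where
  field
    varsOK   : vars A ≡ ⌈log₂ states D ⌉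
    enc      : Fin (states D) → Assignment (vars A)
    encInj   : ∀ s s' → enc s ≗ enc s' → s ≡ s'
    initOK   : ∀ Z → (S A Z ≡ true) ⇔ (Z ≗ enc (init D))
    transOK  : ∀ Z P Z' → (T A Z P Z' ≡ true) ⇔
                 (Σ (Fin (states D)) λ s → Σ (Fin (states D)) λ s' →
                    (Z ≗ enc s) × (Z' ≗ enc s') × (δ D s P ≡ s'))
    finalOK  : ∀ Z → (F A Z ≡ true) ⇔
                 (Σ (Fin (states D)) λ s → (Z ≗ enc s) × (final D s ≡ true))

_∩ˢ_ : ∀ {p} → SymDFA p → SymDFA p → SymDFA p
A₁ ∩ˢ A₂ = record
  { vars = m₁ + m₂
  ; S = λ Z → S A₁ (left Z) ∧ S A₂ (right Z)
  ; T = λ Z P Z' → T A₁ (left Z) P (left Z') ∧ T A₂ (right Z) P (right Z')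
  ; F = λ Z → F A₁ (left Z) ∧ F A₂ (right Z)
  }
  where
  m₁ = vars A₁
  m₂ = vars A₂
  left : Assignment (m₁ + m₂) → Assignment m₁
  left Z i = Z (i ↑ˡ m₂)
  right : Assignment (m₁ + m₂) → Assignment m₂
  right Z i = Z (m₁ ↑ʳ i)

-- The algorithm Lisa as a (nondeterministic) transition system.
-- Parameters: thresholds t₁ t₂, and the measure `nodes` giving the number
-- of BDD nodes of a transition relation (used only to pick the two
-- smallest symbolic DFAs in step 4).

data Config (p : ℕ) : Set where
  explicit : List (DFA p) → Config p
  symbolic : List (SymDFA p) → Config p
  done     : SymDFA p → Config p

Nodes : ℕ → Set
Nodes p = (m : ℕ) → TransRel p m → ℕ

cost : ∀ {p} → Nodes p → SymDFA p → ℕ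
cost nodes A = nodes (vars A) (T A)

InitialCollection : ∀ {p} → List⁺ (Formula p) → List (DFA p) → Set
InitialCollection φs Ds =
  Pointwise (λ φ D → Minimal D × RecognisesFormula D φ) (toList φs) Ds

data Step {p : ℕ} (t₁ t₂ : ℕ) (nodes : Nodes p) : Config p → Config p → Set where
  single : ∀ {D A} → SymRep D A → Step t₁ t₂ nodes (explicit (D ∷ [])) (done A)
  mergeContinue : ∀ {Ds D₁ D₂ rest D} →
    Ds ↭ (D₁ ∷ D₂ ∷ rest) → states D₁ ≤ states D₂ →
    All (λ E → states D₂ ≤ states E) rest →
    states D₁ < t₁ → states D₁ * states D₂ < t₂ →
    Minimal D → RecognisesIntersection D D₁ D₂ →
    ¬ (rest ≡ []) →
    Step t₁ t₂ nodes (explicit Ds) (explicit (D ∷ rest))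
  mergeFinish : ∀ {Ds D₁ D₂ D A} →
    Ds ↭ (D₁ ∷ D₂ ∷ []) → states D₁ ≤ states D₂ →
    states D₁ < t₁ → states D₁ * states D₂ < t₂ →
    Minimal D → RecognisesIntersection D D₁ D₂ → SymRep D A →
    Step t₁ t₂ nodes (explicit Ds) (done A)
  switch : ∀ {Ds D₁ D₂ rest As} →
    Ds ↭ (D₁ ∷ D₂ ∷ rest) → states D₁ ≤ states D₂ →
    All (λ E → states D₂ ≤ states E) rest →
    ¬ ((states D₁ < t₁) × (states D₁ * states D₂ < t₂)) →
    Pointwise SymRep (D₁ ∷ D₂ ∷ rest) As →
    Step t₁ t₂ nodes (explicit Ds) (symbolic As)
  symMerge : ∀ {As A₁ A₂ rest} →
    As ↭ (A₁ ∷ A₂ ∷ rest) → cost nodes A₁ ≤ cost nodes A₂ →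
    All (λ B → cost nodes A₂ ≤ cost nodes B) rest →
    Step t₁ t₂ nodes (symbolic As) (symbolic ((A₁ ∩ˢ A₂) ∷ rest))
  symFinish : ∀ {A} → Step t₁ t₂ nodes (symbolic (A ∷ [])) (done A)

IsDone : ∀ {p} → Config p → Set
IsDone (done _) = ⊤
IsDone _ = ⊥

-- Each conjunct has a minimal DFA. The truth values of all subformulas at a position of a
-- trace are determined by the letter there and the values at the next position, so reading
-- traces backwards is deterministic, and the subset construction on this backward automaton
-- is a forward DFA with finitely many states. Such a DFA is minimised by repeatedly deleting
-- an unreachable state or merging two equivalent ones; both are decidable because a shortest
-- witnessing word never visits a state twice, and a DFA without either is minimal since
-- distinct states have distinct residual languages.
--
-- Every step of Lisa preserves the language of the conjunction of the current collection
-- (intersection of explicit DFAs, conjunction on disjoint state variables for symbolic ones),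
-- keeps each explicit DFA recognising some LTLf formula (so the minimal DFA demanded by an
-- explicit merge exists), and strictly decreases the number of automata, counted twice while
-- explicit. A well-formed collection that is not finished always admits a step.

module Submission where

open import Defs
open import Data.Bool using (Bool; true; false; _∧_; _∨_; not)
import Data.Bool as Bool
open import Data.Empty using (⊥-elim)
open import Data.Unit using (⊤; tt)
open import Data.Fin
  using (Fin; zero; suc; toℕ; combine; splitAt; _↑ˡ_; _↑ʳ_; inject≤; funToFin; finToFun; punchIn; punchOut)
open import Data.Fin.Properties
  using ( 2↔Bool; 1↔⊤; *↔×; splitAt-↑ˡ; splitAt-↑ʳ; toℕ<n; combine-injective; finToFun-funToFin
        ; funToFin-finToFin; inject≤-injective; all?; any?; ¬∀⟶∃¬; pigeonhole; injective⇒≤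
        ; punchIn-punchOut)
  renaming (_≟_ to _≟ᶠ_)
open import Data.List using (List; []; _∷_; _++_; length; take; drop; foldr)
import Data.List as List
open import Data.List.Properties using (length-++; length-take; length-drop; take++drop≡id)
open import Data.List.NonEmpty using (List⁺; _∷_)
import Data.List.NonEmpty as List⁺
open import Data.List.Relation.Unary.All using (All; []; _∷_)
import Data.List.Relation.Unary.All as All
open import Data.List.Relation.Binary.Pointwise using (Pointwise; []; _∷_)
open import Data.List.Relation.Binary.Pointwise.Properties using (Pointwise-length)
open import Data.List.Relation.Binary.Permutation.Propositional using (_↭_; ↭-refl; ↭-sym; ↭-trans; prep; swap)
open import Data.List.Relation.Binary.Permutation.Propositional.Properties using (All-resp-↭; ↭-length)
open import Data.Nat using (ℕ; zero; suc; _+_; _*_; _^_; _∸_; _≤_; _<_; z≤n; s≤s; s≤s⁻¹; _<?_; _≤?_; ⌈_/2⌉; ⌊_/2⌋)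
open import Data.Nat.Properties
open import Data.Nat.Logarithm using (⌈log₂_⌉)
open import Data.Nat.Logarithm.Core using (⌈log2⌉)
open import Data.Nat.Induction using (<-wellFounded)
open import Data.Product using (Σ; ∃; ∃₂; _×_; _,_; proj₁; proj₂)
open import Data.Sum using (_⊎_; inj₁; inj₂; [_,_]′)
open import Function using (_∘_; id; case_of_)
open import Function.Bundles using (_⇔_; mk⇔; _↔_; Inverse; Equivalence)
open Equivalence using (to; from)
open import Function.Properties.Inverse using (↔-sym; ↔-trans)
open import Function.Properties.Equivalence using () renaming (refl to ⇔-refl; sym to ⇔-sym; trans to ⇔-trans)
open import Data.Product.Function.NonDependent.Propositional using (_×-⇔_; _×-↔_)
open import Data.Sum.Function.Propositional using (_⊎-⇔_)
open import Induction.WellFounded using (Acc; acc; module Subrelation)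
import Relation.Binary.Construct.On as On
open import Relation.Binary.Construct.Closure.ReflexiveTransitive using (Star; ε; _◅_)
open import Relation.Nullary using (¬_; Dec; yes; no; does; _×-dec_; _⊎-dec_; ¬?)
open import Relation.Nullary.Decidable using (map′; decidable-stable)
open import Relation.Binary.PropositionalEquality
  using (_≡_; _≢_; _≗_; refl; sym; trans; cong; cong₂; subst; module ≡-Reasoning)

does⇔ : ∀ {a} {A : Set a} (a? : Dec A) → (does a? ≡ true) ⇔ A
does⇔ (yes a) = mk⇔ (λ _ → a) (λ _ → refl)
does⇔ (no ¬a) = mk⇔ (λ ()) (λ a → ⊥-elim (¬a a))

∧-≡-true : ∀ {a b} → (a ∧ b ≡ true) ⇔ (a ≡ true × b ≡ true)
∧-≡-true {true} = mk⇔ (refl ,_) proj₂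
∧-≡-true {false} = mk⇔ (λ ()) (λ ())

∨-≡-true : ∀ {a b} → (a ∨ b ≡ true) ⇔ (a ≡ true ⊎ b ≡ true)
∨-≡-true {true} = mk⇔ (λ _ → inj₁ refl) (λ _ → refl)
∨-≡-true {false} = mk⇔ inj₂ λ { (inj₁ ()) ; (inj₂ b) → b }

not-≡-true : ∀ {a} {A : Set} → (a ≡ true) ⇔ A → (not a ≡ true) ⇔ (¬ A)
not-≡-true {true} a⇔A = mk⇔ (λ ()) λ ¬A → ⊥-elim (¬A (to a⇔A refl))
not-≡-true {false} a⇔A = mk⇔ (λ _ A → case from a⇔A A of λ ()) (λ _ → refl)

≡⇒≡-true⇔ : ∀ {a b : Bool} → a ≡ b → (a ≡ true) ⇔ (b ≡ true)
≡⇒≡-true⇔ refl = ⇔-refl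

⇔⇒≡ : ∀ {a b : Bool} → (a ≡ true) ⇔ (b ≡ true) → a ≡ b
⇔⇒≡ {true} a⇔b = sym (to a⇔b refl)
⇔⇒≡ {false} {true} a⇔b = from a⇔b refl
⇔⇒≡ {false} {false} _ = refl

module BoolFin = Inverse 2↔Bool

encode : ∀ {m} → Assignment m → Fin (2 ^ m)
encode Z = funToFin (BoolFin.from ∘ Z)

decode : ∀ {m} → Fin (2 ^ m) → Assignment m
decode i = BoolFin.to ∘ finToFun i

decode-encode : ∀ {m} (Z : Assignment m) → decode (encode Z) ≗ Z
decode-encode Z j =
  trans (cong BoolFin.to (finToFun-funToFin (BoolFin.from ∘ Z) j)) (BoolFin.strictlyInverseˡ (Z j))

funToFin-cong : ∀ {m n} {f g : Fin m → Fin n} → f ≗ g → funToFin f ≡ funToFin g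
funToFin-cong {zero} f≗g = refl
funToFin-cong {suc m} f≗g = cong₂ combine (f≗g zero) (funToFin-cong (f≗g ∘ suc))

encode-cong : ∀ {m} {Z Z′ : Assignment m} → Z ≗ Z′ → encode Z ≡ encode Z′
encode-cong Z≗Z′ = funToFin-cong (cong BoolFin.from ∘ Z≗Z′)

encode-decode : ∀ {m} (i : Fin (2 ^ m)) → encode {m} (decode i) ≡ i
encode-decode {m} i =
  trans (funToFin-cong (BoolFin.strictlyInverseʳ ∘ finToFun {2} {m} i)) (funToFin-finToFin {m} {2} i)

decode-injective : ∀ {m} {i j : Fin (2 ^ m)} → decode {m} i ≗ decode j → i ≡ j
decode-injective {m} {i} {j} eq =
  trans (sym (encode-decode {m} i)) (trans (encode-cong eq) (encode-decode {m} j))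

×↔Fin : ∀ {A B : Set} {m n} → A ↔ Fin m → B ↔ Fin n → (A × B) ↔ Fin (m * n)
×↔Fin A↔Fin B↔Fin = ↔-trans (A↔Fin ×-↔ B↔Fin) (↔-sym *↔×)

n≤⌈n/2⌉+⌈n/2⌉ : ∀ n → n ≤ ⌈ n /2⌉ + ⌈ n /2⌉
n≤⌈n/2⌉+⌈n/2⌉ n = begin
  n                   ≡⟨ ⌊n/2⌋+⌈n/2⌉≡n n ⟨
  ⌊ n /2⌋ + ⌈ n /2⌉   ≤⟨ +-monoˡ-≤ ⌈ n /2⌉ (⌊n/2⌋≤⌈n/2⌉ n) ⟩
  ⌈ n /2⌉ + ⌈ n /2⌉   ∎
  where open ≤-Reasoning

n≤2^⌈log₂n⌉ : ∀ n → n ≤ 2 ^ ⌈log₂ n ⌉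
n≤2^⌈log₂n⌉ n = go n (<-wellFounded n)
  where
  go : ∀ n (rec : Acc _<_ n) → n ≤ 2 ^ ⌈log2⌉ n rec
  go zero rec = z≤n
  go (suc zero) rec = s≤s z≤n
  go (suc (suc n)) (acc rs) = begin
    2 + n                 ≤⟨ s≤s (s≤s (n≤⌈n/2⌉+⌈n/2⌉ n)) ⟩
    2 + (c + c)           ≡⟨ cong suc (+-suc c c) ⟨
    suc c + suc c         ≤⟨ +-mono-≤ ih (≤-trans ih (≤-reflexive (sym (+-identityʳ _)))) ⟩
    2 ^ suc (⌈log2⌉ (suc c) (rs (⌈n/2⌉<n n))) ∎
    where
    open ≤-Reasoning
    c = ⌈ n /2⌉
    ih = go (suc c) (rs (⌈n/2⌉<n n))

∃-letter? : ∀ {p} {P : Letter p → Set} → (∀ {a b} → a ≗ b → P a → P b) →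
  (∀ a → Dec (P a)) → Dec (∃ P)
∃-letter? {p} resp P? =
  map′ (λ (i , Pi) → decode i , Pi) (λ (a , Pa) → encode a , resp (sym ∘ decode-encode a) Pa)
       (any? (P? ∘ decode {p}))

i+[n∸j]<n : ∀ {i j n} → i < j → j ≤ n → i + (n ∸ j) < n
i+[n∸j]<n {i} {j} {n} i<j j≤n = begin-strict
  i + (n ∸ j)  <⟨ +-monoˡ-< (n ∸ j) i<j ⟩
  j + (n ∸ j)  ≡⟨ m+[n∸m]≡n j≤n ⟩
  n            ∎
  where open ≤-Reasoning

module Search {p m : ℕ} {Q : Set} (move : Q → Letter p → Q)
  (move-resp : ∀ q {a b} → a ≗ b → move q a ≡ move q b)
  (index : Q → Fin m) (index-injective : ∀ {q q′} → index q ≡ index q′ → q ≡ q′) where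

  trace : Q → Word p → Q
  trace q [] = q
  trace q (a ∷ w) = trace (move q a) w

  trace-++ : ∀ q u v → trace q (u ++ v) ≡ trace (trace q u) v
  trace-++ q [] v = refl
  trace-++ q (a ∷ u) v = trace-++ (move q a) u v

  shorten : ∀ q w → m ≤ length w → ∃ λ w′ → length w′ < length w × trace q w′ ≡ trace q w
  shorten q w m≤∣w∣ with pigeonhole (s≤s m≤∣w∣) (λ i → index (trace q (take (toℕ i) w)))
  ... | i , j , i<j , same-index = take (toℕ i) w ++ drop (toℕ j) w , shorter , same-state
    where
    j≤∣w∣ : toℕ j ≤ length w
    j≤∣w∣ = s≤s⁻¹ (toℕ<n j)
    shorter : length (take (toℕ i) w ++ drop (toℕ j) w) < length w
    shorter = begin-strict
      length (take (toℕ i) w ++ drop (toℕ j) w) ≡⟨ length-++ (take (toℕ i) w) ⟩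
      length (take (toℕ i) w) + length (drop (toℕ j) w)
        ≡⟨ cong₂ _+_ (trans (length-take (toℕ i) w) (m≤n⇒m⊓n≡m (<⇒≤ (<-≤-trans i<j j≤∣w∣))))
                     (length-drop (toℕ j) w) ⟩
      toℕ i + (length w ∸ toℕ j)                <⟨ i+[n∸j]<n i<j j≤∣w∣ ⟩
      length w                                  ∎
      where open ≤-Reasoning
    same-state : trace q (take (toℕ i) w ++ drop (toℕ j) w) ≡ trace q w
    same-state = begin
      trace q (take (toℕ i) w ++ drop (toℕ j) w)    ≡⟨ trace-++ q (take (toℕ i) w) _ ⟩
      trace (trace q (take (toℕ i) w)) (drop (toℕ j) w)
        ≡⟨ cong (λ q′ → trace q′ (drop (toℕ j) w)) (index-injective same-index) ⟩
      trace (trace q (take (toℕ j) w)) (drop (toℕ j) w) ≡⟨ trace-++ q (take (toℕ j) w) _ ⟨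
      trace q (take (toℕ j) w ++ drop (toℕ j) w)    ≡⟨ cong (trace q) (take++drop≡id (toℕ j) w) ⟩
      trace q w                                     ∎
      where open ≡-Reasoning

  short-witness : ∀ q w → ∃ λ w′ → length w′ < m × trace q w′ ≡ trace q w
  short-witness q w = go (length w) w ≤-refl
    where
    go : ∀ n w → length w ≤ n → ∃ λ w′ → length w′ < m × trace q w′ ≡ trace q w
    go n w ∣w∣≤n with length w <? m
    ... | yes ∣w∣<m = w , ∣w∣<m , refl
    ... | no ∣w∣≮m with shorten q w (≮⇒≥ ∣w∣≮m) | n
    ...   | w′ , shorter , _ | zero = ⊥-elim (n≮0 (<-≤-trans shorter ∣w∣≤n))
    ...   | w′ , shorter , same | suc n′ with go n′ w′ (s≤s⁻¹ (<-≤-trans shorter ∣w∣≤n))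
    ...     | w″ , short , same′ = w″ , short , trans same′ same

  module _ {G : Q → Set} (G? : ∀ q → Dec (G q)) where

    bounded? : ∀ k q → Dec (∃ λ w → length w < k × G (trace q w))
    bounded? zero q = no λ ()
    bounded? (suc k) q = map′ extend restrict (G? q ⊎-dec ∃-letter? resp (λ a → bounded? k (move q a)))
      where
      resp : ∀ {a b} → a ≗ b → (∃ λ w → length w < k × G (trace (move q a) w)) →
                                 (∃ λ w → length w < k × G (trace (move q b) w))
      resp a≗b (w , lt , g) = w , lt , subst (λ q′ → G (trace q′ w)) (move-resp q a≗b) g
      extend : G q ⊎ (∃ λ a → ∃ λ w → length w < k × G (trace (move q a) w)) →
               ∃ λ w → length w < suc k × G (trace q w)
      extend (inj₁ g) = [] , s≤s z≤n , g
      extend (inj₂ (a , w , lt , g)) = a ∷ w , s≤s lt , g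
      restrict : (∃ λ w → length w < suc k × G (trace q w)) →
                 G q ⊎ (∃ λ a → ∃ λ w → length w < k × G (trace (move q a) w))
      restrict ([] , _ , g) = inj₁ g
      restrict (a ∷ w , s≤s lt , g) = inj₂ (a , w , lt , g)

    search? : ∀ q → Dec (∃ λ w → G (trace q w))
    search? q = map′ (λ (w , _ , g) → w , g) shortened (bounded? m q)
      where
      shortened : (∃ λ w → G (trace q w)) → ∃ λ w → length w < m × G (trace q w)
      shortened (w , g) with short-witness q w
      ... | w′ , short , same = w′ , short , subst G (sym same) g

module _ {p : ℕ} where

  dfa : ∀ n → Fin n → (Fin n → Letter p → Fin n) → (Fin n → Bool) → DFA p
  dfa n i d f = record { states = n ; init = i ; δ = d ; final = f }

  acceptsAt : (D : DFA p) → Fin (states D) → Word p → Bool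
  acceptsAt D s w = final D (run D s w)

  -- Letters are functions, so enumerating 2^Prop reaches them only up to ≗; deciding
  -- anything about runs needs δ to respect ≗.
  RespectsLetters : DFA p → Set
  RespectsLetters D = ∀ s {a b} → a ≗ b → δ D s a ≡ δ D s b

  Reachable : (D : DFA p) → Fin (states D) → Set
  Reachable D x = ∃ λ w → run D (init D) w ≡ x

  Equivalent : (D : DFA p) → Fin (states D) → Fin (states D) → Set
  Equivalent D s t = ∀ w → acceptsAt D s w ≡ acceptsAt D t w

  run-++ : ∀ (D : DFA p) s u v → run D s (u ++ v) ≡ run D (run D s u) v
  run-++ D s [] v = refl
  run-++ D s (a ∷ u) v = run-++ D (δ D s a) u v

  acceptsAt-run : ∀ (D : DFA p) s u v → acceptsAt D (run D s u) v ≡ acceptsAt D s (u ++ v)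
  acceptsAt-run D s u v = cong (final D) (sym (run-++ D s u v))

  reachable-δ : ∀ (D : DFA p) {x} a → Reachable D x → Reachable D (δ D x a)
  reachable-δ D a (u , refl) = u ++ a ∷ [] , run-++ D (init D) u (a ∷ [])

  Reduced : DFA p → Set
  Reduced D = (∀ x → Reachable D x) × (∀ s t → Equivalent D s t → s ≡ t)

  unreachable⇒≢init : ∀ (D : DFA p) {s} → ¬ Reachable D s → s ≢ init D
  unreachable⇒≢init D unreachable s≡init = unreachable ([] , sym s≡init)

  reduced⇒minimal : ∀ (D : DFA p) → Reduced D → Minimal D
  reduced⇒minimal D (reach , distinct) D′ same = injective⇒≤ {f = state′} state′-injective
    where
    state′ : Fin (states D) → Fin (states D′)
    state′ x = run D′ (init D′) (proj₁ (reach x))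
    acceptsAt-state′ : ∀ x v → acceptsAt D x v ≡ acceptsAt D′ (state′ x) v
    acceptsAt-state′ x v with reach x
    ... | u , refl = trans (acceptsAt-run D (init D) u v)
                       (trans (sym (same (u ++ v))) (sym (acceptsAt-run D′ (init D′) u v)))
    state′-injective : ∀ {x y} → state′ x ≡ state′ y → x ≡ y
    state′-injective {x} {y} eq = distinct x y λ v →
      trans (acceptsAt-state′ x v) (trans (cong (λ z → acceptsAt D′ z v) eq) (sym (acceptsAt-state′ y v)))

  module _ (D : DFA p) (resp : RespectsLetters D) where

    private
      StatePair = Fin (states D) × Fin (states D)

      pair-δ : StatePair → Letter p → StatePair
      pair-δ (s , t) a = δ D s a , δ D t a

      pair-δ-resp : ∀ q {a b} → a ≗ b → pair-δ q a ≡ pair-δ q b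
      pair-δ-resp (s , t) a≗b = cong₂ _,_ (resp s a≗b) (resp t a≗b)

      pair-index : StatePair → Fin (states D * states D)
      pair-index (s , t) = combine s t

      pair-index-injective : ∀ {q q′} → pair-index q ≡ pair-index q′ → q ≡ q′
      pair-index-injective {s , t} {s′ , t′} eq with combine-injective s t s′ t′ eq
      ... | refl , refl = refl

      module Single = Search (δ D) resp id id
      module Pair = Search pair-δ pair-δ-resp pair-index pair-index-injective

      trace≡run : ∀ s w → Single.trace s w ≡ run D s w
      trace≡run s [] = refl
      trace≡run s (a ∷ w) = trace≡run (δ D s a) w

      pair-trace≡run : ∀ s t w → Pair.trace (s , t) w ≡ (run D s w , run D t w)
      pair-trace≡run s t [] = refl
      pair-trace≡run s t (a ∷ w) = pair-trace≡run (δ D s a) (δ D t a) w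

    reachable? : ∀ x → Dec (Reachable D x)
    reachable? x = map′ (λ (w , eq) → w , trans (sym (trace≡run _ w)) eq)
                        (λ (w , eq) → w , trans (trace≡run _ w) eq)
                        (Single.search? (_≟ᶠ x) (init D))

    equivalent? : ∀ s t → Dec (Equivalent D s t)
    equivalent? s t with Pair.search? (λ (s , t) → ¬? (final D s Bool.≟ final D t)) (s , t)
    ... | yes (w , differ) = no λ s≈t → differ (subst (λ (s′ , t′) → final D s′ ≡ final D t′)
                                                        (sym (pair-trace≡run s t w)) (s≈t w))
    ... | no none = yes λ w → decidable-stable (acceptsAt D s w Bool.≟ acceptsAt D t w) λ differ →
                      none (w , subst (λ (s′ , t′) → final D s′ ≢ final D t′)
                                      (sym (pair-trace≡run s t w)) differ)

  module Collapse {n : ℕ} (i : Fin (suc n)) (d : Fin (suc n) → Letter p → Fin (suc n))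
    (f : Fin (suc n) → Bool) {s t : Fin (suc n)} (s≢t : s ≢ t) where

    D : DFA p
    D = dfa (suc n) i d f

    redirect : Fin (suc n) → Σ (Fin (suc n)) (s ≢_)
    redirect x with s ≟ᶠ x
    ... | yes _ = t , s≢t
    ... | no s≢x = x , s≢x

    redirected : Fin (suc n) → Fin (suc n)
    redirected = proj₁ ∘ redirect

    redirect-cases : ∀ x → (x ≡ s × redirected x ≡ t) ⊎ redirected x ≡ x
    redirect-cases x with s ≟ᶠ x
    ... | yes s≡x = inj₁ (sym s≡x , refl)
    ... | no _ = inj₂ refl

    shrink : Fin (suc n) → Fin n
    shrink x = punchOut (proj₂ (redirect x))

    punchIn-shrink : ∀ x → punchIn s (shrink x) ≡ redirected x
    punchIn-shrink x = punchIn-punchOut (proj₂ (redirect x))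

    D′ : DFA p
    D′ = dfa n (shrink i) (λ j a → shrink (d (punchIn s j) a)) (f ∘ punchIn s)

    D′-respects : RespectsLetters D → RespectsLetters D′
    D′-respects resp j a≗b = cong shrink (resp (punchIn s j) a≗b)

    Faithful : Fin (suc n) → Set
    Faithful x = Reachable D (redirected x) × Equivalent D (redirected x) x

    module _ (faithful : ∀ x → Reachable D x → Faithful x) where

      shrink-correct : ∀ x → Reachable D x → ∀ w → acceptsAt D′ (shrink x) w ≡ acceptsAt D x w
      shrink-correct x reach [] = trans (cong f (punchIn-shrink x)) (proj₂ (faithful x reach) [])
      shrink-correct x reach (a ∷ w) = begin
        acceptsAt D′ (shrink (d (punchIn s (shrink x)) a)) w
          ≡⟨ cong (λ y → acceptsAt D′ (shrink (d y a)) w) (punchIn-shrink x) ⟩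
        acceptsAt D′ (shrink (d (redirected x) a)) w
          ≡⟨ shrink-correct (d (redirected x) a) (reachable-δ D a (proj₁ (faithful x reach))) w ⟩
        acceptsAt D (redirected x) (a ∷ w)
          ≡⟨ proj₂ (faithful x reach) (a ∷ w) ⟩
        acceptsAt D x (a ∷ w) ∎
        where open ≡-Reasoning

      collapse-correct : ∀ w → accepts D′ w ≡ accepts D w
      collapse-correct = shrink-correct i ([] , refl)

    unreachable-collapse-correct : ¬ Reachable D s → ∀ w → accepts D′ w ≡ accepts D w
    unreachable-collapse-correct unreachable = collapse-correct faithful
      where
      faithful : ∀ x → Reachable D x → Faithful x
      faithful x reach with redirect-cases x
      ... | inj₁ (refl , _) = ⊥-elim (unreachable reach)
      ... | inj₂ eq rewrite eq = reach , λ _ → refl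

    equivalent-collapse-correct : (∀ x → Reachable D x) → Equivalent D s t → ∀ w → accepts D′ w ≡ accepts D w
    equivalent-collapse-correct all-reachable s≈t = collapse-correct faithful
      where
      faithful : ∀ x → Reachable D x → Faithful x
      faithful x _ with redirect-cases x
      ... | inj₁ (refl , eq) rewrite eq = all-reachable t , λ w → sym (s≈t w)
      ... | inj₂ eq rewrite eq = all-reachable x , λ _ → refl

  Collapsible : ∀ {n} i d f → Set
  Collapsible {n} i d f = ∃₂ λ s t → Σ (s ≢ t) λ s≢t →
    ∀ w → accepts (Collapse.D′ i d f s≢t) w ≡ accepts (dfa (suc n) i d f) w

  reduced-or-collapsible : ∀ {n} i d f → RespectsLetters (dfa (suc n) i d f) →
    Reduced (dfa (suc n) i d f) ⊎ Collapsible i d f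
  reduced-or-collapsible {n} i d f resp with all? (reachable? (dfa (suc n) i d f) resp)
  ... | no ¬all-reachable with ¬∀⟶∃¬ _ _ (reachable? (dfa (suc n) i d f) resp) ¬all-reachable
  ...   | s , unreachable = inj₂ (s , i , s≢i , Collapse.unreachable-collapse-correct i d f s≢i unreachable)
    where s≢i = unreachable⇒≢init (dfa (suc n) i d f) unreachable
  reduced-or-collapsible {n} i d f resp | yes all-reachable
    with any? (λ s → any? λ t → ¬? (s ≟ᶠ t) ×-dec equivalent? (dfa (suc n) i d f) resp s t)
  ... | yes (s , t , s≢t , s≈t) =
    inj₂ (s , t , s≢t , Collapse.equivalent-collapse-correct i d f s≢t all-reachable s≈t)
  ... | no no-equivalent-pair = inj₁ (all-reachable , λ s t s≈t →
    decidable-stable (s ≟ᶠ t) λ s≢t → no-equivalent-pair (s , t , s≢t , s≈t))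

  MinimalEquivalent : DFA p → Set
  MinimalEquivalent D = ∃ λ M → Minimal M × (∀ w → accepts M w ≡ accepts D w)

  MinimalEquivalent-resp : ∀ {D D′} → (∀ w → accepts D′ w ≡ accepts D w) →
    MinimalEquivalent D′ → MinimalEquivalent D
  MinimalEquivalent-resp same (M , minimal , M≡D′) = M , minimal , λ w → trans (M≡D′ w) (same w)

  minimize : ∀ n i d f → RespectsLetters (dfa n i d f) → MinimalEquivalent (dfa n i d f)
  minimize (suc n) i d f resp with reduced-or-collapsible i d f resp
  ... | inj₁ reduced = dfa (suc n) i d f , reduced⇒minimal _ reduced , λ _ → refl
  ... | inj₂ (s , t , s≢t , same) =
    MinimalEquivalent-resp {dfa (suc n) i d f} {D′} same
      (minimize n (init D′) (δ D′) (final D′) (D′-respects resp))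
    where open Collapse i d f s≢t

  minimal-equivalent : ∀ D → RespectsLetters D → MinimalEquivalent D
  minimal-equivalent D = minimize (states D) (init D) (δ D) (final D)

  module Reversal {m : ℕ} {B : Set} (B↔Fin : B ↔ Fin m)
    (back : Letter p → B → B) (end : B) (accepting : B → Bool) where

    private module B↔Fin = Inverse B↔Fin

    -- The state reached on u is the set of b with accepting (foldr back b u): the subset
    -- construction for the automaton that reads words backwards with back.
    ⟦_⟧ : Fin (2 ^ m) → B → Bool
    ⟦ s ⟧ b = decode s (B↔Fin.to b)

    reversal : DFA p
    reversal = dfa (2 ^ m) (encode (accepting ∘ B↔Fin.from))
                   (λ s a → encode (λ j → ⟦ s ⟧ (back a (B↔Fin.from j)))) (λ s → ⟦ s ⟧ end)

    ⟦δ⟧ : ∀ s a b → ⟦ δ reversal s a ⟧ b ≡ ⟦ s ⟧ (back a b)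
    ⟦δ⟧ s a b = trans (decode-encode _ (B↔Fin.to b)) (cong (⟦ s ⟧ ∘ back a) (B↔Fin.strictlyInverseʳ b))

    ⟦run⟧ : ∀ s u b → ⟦ run reversal s u ⟧ b ≡ ⟦ s ⟧ (foldr back b u)
    ⟦run⟧ s [] b = refl
    ⟦run⟧ s (a ∷ u) b = trans (⟦run⟧ (δ reversal s a) u b) (⟦δ⟧ s a (foldr back b u))

    accepts-reversal : ∀ w → accepts reversal w ≡ accepting (foldr back end w)
    accepts-reversal w = begin
      ⟦ run reversal (init reversal) w ⟧ end                ≡⟨ ⟦run⟧ (init reversal) w end ⟩
      ⟦ init reversal ⟧ (foldr back end w)                  ≡⟨ decode-encode (accepting ∘ B↔Fin.from) _ ⟩
      accepting (B↔Fin.from (B↔Fin.to (foldr back end w))) ≡⟨ cong accepting (B↔Fin.strictlyInverseʳ _) ⟩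
      accepting (foldr back end w)                          ∎
      where open ≡-Reasoning

    reversal-respects : (∀ b {a a′} → a ≗ a′ → back a b ≡ back a′ b) → RespectsLetters reversal
    reversal-respects back-resp s a≗a′ = encode-cong λ j → cong ⟦ s ⟧ (back-resp (B↔Fin.from j) a≗a′)

module _ {p : ℕ} where

  shift : ∀ (χ : Formula p) a w i → ((a ∷ w) ⊨[ suc i ] χ) ⇔ (w ⊨[ i ] χ)
  shift (atom x) a w i = mk⇔ (λ { (s≤s h , e) → h , e }) (λ { (h , e) → s≤s h , e })
  shift (`¬ φ) a w i = mk⇔ (λ ¬φ holds → ¬φ (from (shift φ a w i) holds))
                           (λ ¬φ holds → ¬φ (to (shift φ a w i) holds))
  shift (φ `∧ ψ) a w i = shift φ a w i ×-⇔ shift ψ a w i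
  shift (φ `∨ ψ) a w i = shift φ a w i ⊎-⇔ shift ψ a w i
  shift (`X φ) a w i = mk⇔ (λ { (s≤s h , q) → h , to (shift φ a w (suc i)) q })
                           (λ { (h , q) → s≤s h , from (shift φ a w (suc i)) q })
  shift (φ `U ψ) a w i = mk⇔
    (λ { (suc j , s≤s i≤j , s≤s j< , ψj , φ<j) →
           j , i≤j , j< , to (shift ψ a w j) ψj ,
           λ k i≤k k<j → to (shift φ a w k) (φ<j (suc k) (s≤s i≤k) (s≤s k<j)) })
    (λ { (j , i≤j , j< , ψj , φ<j) →
           suc j , s≤s i≤j , s≤s j< , from (shift ψ a w j) ψj ,
           λ { zero () _ ; (suc k) (s≤s i≤k) (s≤s k<j) → from (shift φ a w k) (φ<j k i≤k k<j) } })
  shift (`F φ) a w i = mk⇔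
    (λ { (suc j , s≤s i≤j , s≤s j< , φj) → j , i≤j , j< , to (shift φ a w j) φj })
    (λ { (j , i≤j , j< , φj) → suc j , s≤s i≤j , s≤s j< , from (shift φ a w j) φj })
  shift (`G φ) a w i = mk⇔
    (λ φ≥ j i≤j j< → to (shift φ a w j) (φ≥ (suc j) (s≤s i≤j) (s≤s j<)))
    (λ { φ≥ zero () _ ; φ≥ (suc j) (s≤s i≤j) (s≤s j<) → from (shift φ a w j) (φ≥ j i≤j j<) })

  unfold-X : ∀ φ a w → ((a ∷ w) ⊨[ 0 ] (`X φ)) ⇔ ((0 < length w) × (w ⊨[ 0 ] φ))
  unfold-X φ a w = mk⇔ (λ { (s≤s h , q) → h , to (shift φ a w 0) q })
                       (λ { (h , q) → s≤s h , from (shift φ a w 0) q })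

  unfold-U : ∀ φ ψ a w → ((a ∷ w) ⊨[ 0 ] (φ `U ψ)) ⇔
    (((a ∷ w) ⊨[ 0 ] ψ) ⊎ (((a ∷ w) ⊨[ 0 ] φ) × (w ⊨[ 0 ] (φ `U ψ))))
  unfold-U φ ψ a w = mk⇔
    (λ { (zero , _ , _ , ψ0 , _) → inj₁ ψ0
       ; (suc j , _ , j< , ψj , φ<j) → inj₂ (φ<j 0 z≤n (s≤s z≤n) ,
           to (shift (φ `U ψ) a w 0) (suc j , s≤s z≤n , j< , ψj , λ k _ k<j → φ<j k z≤n k<j)) })
    (λ { (inj₁ ψ0) → 0 , z≤n , s≤s z≤n , ψ0 , (λ _ _ ())
       ; (inj₂ (φ0 , U)) → later φ0 (from (shift (φ `U ψ) a w 0) U) })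
    where
    later : (a ∷ w) ⊨[ 0 ] φ → (a ∷ w) ⊨[ 1 ] (φ `U ψ) → (a ∷ w) ⊨[ 0 ] (φ `U ψ)
    later φ0 (j , _ , j< , ψj , φ<j) =
      j , z≤n , j< , ψj , λ { zero _ _ → φ0 ; (suc k) _ k<j → φ<j (suc k) (s≤s z≤n) k<j }

  unfold-F : ∀ φ a w → ((a ∷ w) ⊨[ 0 ] (`F φ)) ⇔ (((a ∷ w) ⊨[ 0 ] φ) ⊎ (w ⊨[ 0 ] (`F φ)))
  unfold-F φ a w = mk⇔
    (λ { (zero , _ , _ , φ0) → inj₁ φ0
       ; (suc j , _ , j< , φj) → inj₂ (to (shift (`F φ) a w 0) (suc j , s≤s z≤n , j< , φj)) })
    (λ { (inj₁ φ0) → 0 , z≤n , s≤s z≤n , φ0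
       ; (inj₂ F) → let (j , _ , j< , φj) = from (shift (`F φ) a w 0) F in j , z≤n , j< , φj })

  unfold-G : ∀ φ a w → ((a ∷ w) ⊨[ 0 ] (`G φ)) ⇔ (((a ∷ w) ⊨[ 0 ] φ) × (w ⊨[ 0 ] (`G φ)))
  unfold-G φ a w = mk⇔
    (λ φ≥ → φ≥ 0 z≤n (s≤s z≤n) , to (shift (`G φ) a w 0) (λ j _ j< → φ≥ j z≤n j<))
    (λ { (φ0 , G) → λ { zero _ _ → φ0 ; (suc j) _ j< → from (shift (`G φ) a w 0) G (suc j) (s≤s z≤n) j< } })

  nonEmpty : Word p → Bool
  nonEmpty [] = false
  nonEmpty (_ ∷ _) = true

  nonEmpty-≡-true : ∀ w → (nonEmpty w ≡ true) ⇔ (0 < length w)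
  nonEmpty-≡-true [] = mk⇔ (λ ()) (λ ())
  nonEmpty-≡-true (_ ∷ _) = mk⇔ (λ _ → s≤s z≤n) (λ _ → refl)

  truth : Formula p → Word p → Bool
  truth (atom x) [] = false
  truth (atom x) (a ∷ w) = a x
  truth (`¬ φ) w = not (truth φ w)
  truth (φ `∧ ψ) w = truth φ w ∧ truth ψ w
  truth (φ `∨ ψ) w = truth φ w ∨ truth ψ w
  truth (`X φ) [] = false
  truth (`X φ) (a ∷ w) = nonEmpty w ∧ truth φ w
  truth (φ `U ψ) [] = false
  truth (φ `U ψ) (a ∷ w) = truth ψ (a ∷ w) ∨ (truth φ (a ∷ w) ∧ truth (φ `U ψ) w)
  truth (`F φ) [] = false
  truth (`F φ) (a ∷ w) = truth φ (a ∷ w) ∨ truth (`F φ) w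
  truth (`G φ) [] = true
  truth (`G φ) (a ∷ w) = truth φ (a ∷ w) ∧ truth (`G φ) w

  truth-correct : ∀ χ w → (truth χ w ≡ true) ⇔ (w ⊨[ 0 ] χ)
  truth-correct (atom x) [] = mk⇔ (λ ()) (λ ())
  truth-correct (atom x) (a ∷ w) = mk⇔ (s≤s z≤n ,_) λ { (s≤s z≤n , ax) → ax }
  truth-correct (`¬ φ) w = not-≡-true (truth-correct φ w)
  truth-correct (φ `∧ ψ) w = ⇔-trans ∧-≡-true (truth-correct φ w ×-⇔ truth-correct ψ w)
  truth-correct (φ `∨ ψ) w = ⇔-trans ∨-≡-true (truth-correct φ w ⊎-⇔ truth-correct ψ w)
  truth-correct (`X φ) [] = mk⇔ (λ ()) (λ ())
  truth-correct (`X φ) (a ∷ w) =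
    ⇔-trans ∧-≡-true (⇔-trans (nonEmpty-≡-true w ×-⇔ truth-correct φ w) (⇔-sym (unfold-X φ a w)))
  truth-correct (φ `U ψ) [] = mk⇔ (λ ()) λ { (_ , _ , () , _) }
  truth-correct (φ `U ψ) (a ∷ w) = ⇔-trans ∨-≡-true (⇔-trans
    (truth-correct ψ (a ∷ w) ⊎-⇔ ⇔-trans ∧-≡-true (truth-correct φ (a ∷ w) ×-⇔ truth-correct (φ `U ψ) w))
    (⇔-sym (unfold-U φ ψ a w)))
  truth-correct (`F φ) [] = mk⇔ (λ ()) λ { (_ , _ , () , _) }
  truth-correct (`F φ) (a ∷ w) = ⇔-trans ∨-≡-true (⇔-trans
    (truth-correct φ (a ∷ w) ⊎-⇔ truth-correct (`F φ) w) (⇔-sym (unfold-F φ a w)))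
  truth-correct (`G φ) [] = mk⇔ (λ _ _ _ ()) (λ _ → refl)
  truth-correct (`G φ) (a ∷ w) = ⇔-trans ∧-≡-true (⇔-trans
    (truth-correct φ (a ∷ w) ×-⇔ truth-correct (`G φ) w) (⇔-sym (unfold-G φ a w)))

  -- A valuation holds the truth value at one position of every subformula occurrence;
  -- step computes it from the letter there, whether a later position exists, and the
  -- valuation at the next position.
  Val Children : Formula p → Set
  Val χ = Bool × Children χ
  Children (atom _) = ⊤
  Children (`¬ φ) = Val φ
  Children (φ `∧ ψ) = Val φ × Val ψ
  Children (φ `∨ ψ) = Val φ × Val ψ
  Children (`X φ) = Val φ
  Children (φ `U ψ) = Val φ × Val ψ
  Children (`F φ) = Val φ
  Children (`G φ) = Val φ

  valuation : ∀ χ → Word p → Val χ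
  children : ∀ χ → Word p → Children χ
  valuation χ w = truth χ w , children χ w
  children (atom _) w = tt
  children (`¬ φ) w = valuation φ w
  children (φ `∧ ψ) w = valuation φ w , valuation ψ w
  children (φ `∨ ψ) w = valuation φ w , valuation ψ w
  children (`X φ) w = valuation φ w
  children (φ `U ψ) w = valuation φ w , valuation ψ w
  children (`F φ) w = valuation φ w
  children (`G φ) w = valuation φ w

  step : ∀ χ → Letter p → Bool → Val χ → Val χ
  step (atom x) a _ _ = a x , tt
  step (`¬ φ) a more (_ , v) = let v′ = step φ a more v in not (proj₁ v′) , v′
  step (φ `∧ ψ) a more (_ , v , u) =
    let v′ = step φ a more v ; u′ = step ψ a more u in proj₁ v′ ∧ proj₁ u′ , v′ , u′
  step (φ `∨ ψ) a more (_ , v , u) =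
    let v′ = step φ a more v ; u′ = step ψ a more u in proj₁ v′ ∨ proj₁ u′ , v′ , u′
  step (`X φ) a more (_ , v) = more ∧ proj₁ v , step φ a more v
  step (φ `U ψ) a more (h , v , u) =
    let v′ = step φ a more v ; u′ = step ψ a more u in proj₁ u′ ∨ (proj₁ v′ ∧ h) , v′ , u′
  step (`F φ) a more (h , v) = let v′ = step φ a more v in proj₁ v′ ∨ h , v′
  step (`G φ) a more (h , v) = let v′ = step φ a more v in proj₁ v′ ∧ h , v′

  step-valuation : ∀ χ a w → step χ a (nonEmpty w) (valuation χ w) ≡ valuation χ (a ∷ w)
  step-valuation (atom x) a w = refl
  step-valuation (`¬ φ) a w = cong (λ v → not (proj₁ v) , v) (step-valuation φ a w)
  step-valuation (φ `∧ ψ) a w =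
    cong₂ (λ v u → proj₁ v ∧ proj₁ u , v , u) (step-valuation φ a w) (step-valuation ψ a w)
  step-valuation (φ `∨ ψ) a w =
    cong₂ (λ v u → proj₁ v ∨ proj₁ u , v , u) (step-valuation φ a w) (step-valuation ψ a w)
  step-valuation (`X φ) a w = cong (nonEmpty w ∧ truth φ w ,_) (step-valuation φ a w)
  step-valuation (φ `U ψ) a w = cong₂ (λ v u → proj₁ u ∨ (proj₁ v ∧ truth (φ `U ψ) w) , v , u)
    (step-valuation φ a w) (step-valuation ψ a w)
  step-valuation (`F φ) a w = cong (λ v → proj₁ v ∨ truth (`F φ) w , v) (step-valuation φ a w)
  step-valuation (`G φ) a w = cong (λ v → proj₁ v ∧ truth (`G φ) w , v) (step-valuation φ a w)

  step-resp : ∀ χ {a a′} → a ≗ a′ → ∀ more v → step χ a more v ≡ step χ a′ more v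
  step-resp (atom x) a≗a′ more v = cong (_, tt) (a≗a′ x)
  step-resp (`¬ φ) a≗a′ more (_ , v) = cong (λ v → not (proj₁ v) , v) (step-resp φ a≗a′ more v)
  step-resp (φ `∧ ψ) a≗a′ more (_ , v , u) = cong₂ (λ v u → proj₁ v ∧ proj₁ u , v , u)
    (step-resp φ a≗a′ more v) (step-resp ψ a≗a′ more u)
  step-resp (φ `∨ ψ) a≗a′ more (_ , v , u) = cong₂ (λ v u → proj₁ v ∨ proj₁ u , v , u)
    (step-resp φ a≗a′ more v) (step-resp ψ a≗a′ more u)
  step-resp (`X φ) a≗a′ more (_ , v) = cong (more ∧ proj₁ v ,_) (step-resp φ a≗a′ more v)
  step-resp (φ `U ψ) a≗a′ more (h , v , u) = cong₂ (λ v u → proj₁ u ∨ (proj₁ v ∧ h) , v , u)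
    (step-resp φ a≗a′ more v) (step-resp ψ a≗a′ more u)
  step-resp (`F φ) a≗a′ more (h , v) = cong (λ v → proj₁ v ∨ h , v) (step-resp φ a≗a′ more v)
  step-resp (`G φ) a≗a′ more (h , v) = cong (λ v → proj₁ v ∧ h , v) (step-resp φ a≗a′ more v)

  size childrenSize : Formula p → ℕ
  size χ = 2 * childrenSize χ
  childrenSize (atom _) = 1
  childrenSize (`¬ φ) = size φ
  childrenSize (φ `∧ ψ) = size φ * size ψ
  childrenSize (φ `∨ ψ) = size φ * size ψ
  childrenSize (`X φ) = size φ
  childrenSize (φ `U ψ) = size φ * size ψ
  childrenSize (`F φ) = size φ
  childrenSize (`G φ) = size φ

  Val↔Fin : ∀ χ → Val χ ↔ Fin (size χ)
  Children↔Fin : ∀ χ → Children χ ↔ Fin (childrenSize χ)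
  Val↔Fin χ = ×↔Fin (↔-sym 2↔Bool) (Children↔Fin χ)
  Children↔Fin (atom _) = ↔-sym 1↔⊤
  Children↔Fin (`¬ φ) = Val↔Fin φ
  Children↔Fin (φ `∧ ψ) = ×↔Fin (Val↔Fin φ) (Val↔Fin ψ)
  Children↔Fin (φ `∨ ψ) = ×↔Fin (Val↔Fin φ) (Val↔Fin ψ)
  Children↔Fin (`X φ) = Val↔Fin φ
  Children↔Fin (φ `U ψ) = ×↔Fin (Val↔Fin φ) (Val↔Fin ψ)
  Children↔Fin (`F φ) = Val↔Fin φ
  Children↔Fin (`G φ) = Val↔Fin φ

  module FormulaAutomaton (χ : Formula p) where

    back : Letter p → Bool × Val χ → Bool × Val χ
    back a (more , v) = true , step χ a more v

    accepting : Bool × Val χ → Bool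
    accepting (more , v) = more ∧ proj₁ v

    open Reversal (×↔Fin (↔-sym 2↔Bool) (Val↔Fin χ)) back (false , valuation χ []) accepting
      using (reversal; accepts-reversal; reversal-respects) public

    foldr-back : ∀ w → foldr back (false , valuation χ []) w ≡ (nonEmpty w , valuation χ w)
    foldr-back [] = refl
    foldr-back (a ∷ w) =
      trans (cong (back a) (foldr-back w)) (cong (true ,_) (step-valuation χ a w))

    reversal-recognises : RecognisesFormula reversal χ
    reversal-recognises w = ⇔-trans
      (≡⇒≡-true⇔ (trans (accepts-reversal w) (cong accepting (foldr-back w))))
      (⇔-trans ∧-≡-true (nonEmpty-≡-true w ×-⇔ truth-correct χ w))

    back-resp : ∀ b {a a′} → a ≗ a′ → back a b ≡ back a′ b
    back-resp (more , v) a≗a′ = cong (true ,_) (step-resp χ a≗a′ more v)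

    minimal-recogniser : ∃ λ M → Minimal M × RecognisesFormula M χ
    minimal-recogniser with minimal-equivalent reversal (reversal-respects back-resp)
    ... | M , minimal , M≡reversal =
      M , minimal , λ w → ⇔-trans (≡⇒≡-true⇔ (M≡reversal w)) (reversal-recognises w)

  minimalDFA : ∀ χ → ∃ λ M → Minimal M × RecognisesFormula M χ
  minimalDFA = FormulaAutomaton.minimal-recogniser

_≗?_ : ∀ {m} (Z Z′ : Assignment m) → Dec (Z ≗ Z′)
Z ≗? Z′ = all? (λ i → Z i Bool.≟ Z′ i)

≗-resp : ∀ {m} {Z Z′ X : Assignment m} → Z ≗ Z′ → (Z ≗ X) ⇔ (Z′ ≗ X)
≗-resp Z≗Z′ = mk⇔ (λ Z≗X i → trans (sym (Z≗Z′ i)) (Z≗X i)) (λ Z′≗X i → trans (Z≗Z′ i) (Z′≗X i))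

module _ {p : ℕ} where

  stateEncoding : (D : DFA p) → Fin (states D) → Assignment ⌈log₂ states D ⌉
  stateEncoding D s = decode {⌈log₂ states D ⌉} (inject≤ s (n≤2^⌈log₂n⌉ (states D)))

  module _ (D : DFA p) where
    private enc = stateEncoding D

    initial? : ∀ Z → Dec (Z ≗ enc (init D))
    initial? Z = Z ≗? enc (init D)

    transition? : ∀ Z P Z′ → Dec (∃ λ s → ∃ λ s′ → (Z ≗ enc s) × (Z′ ≗ enc s′) × (δ D s P ≡ s′))
    transition? Z P Z′ = any? λ s → any? λ s′ → (Z ≗? enc s) ×-dec (Z′ ≗? enc s′) ×-dec (δ D s P ≟ᶠ s′)

    final? : ∀ Z → Dec (∃ λ s → (Z ≗ enc s) × (final D s ≡ true))
    final? Z = any? λ s → (Z ≗? enc s) ×-dec (final D s Bool.≟ true)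

    symbolicDFA : SymDFA p
    symbolicDFA = record
      { vars = ⌈log₂ states D ⌉
      ; S = does ∘ initial?
      ; T = λ Z P Z′ → does (transition? Z P Z′)
      ; F = does ∘ final?
      }

    symbolicDFA-represents : SymRep D symbolicDFA
    symbolicDFA-represents = record
      { varsOK = refl
      ; enc = enc
      ; encInj = λ s s′ enc≗ → inject≤-injective _ _ s s′ (decode-injective enc≗)
      ; initOK = does⇔ ∘ initial?
      ; transOK = λ Z P Z′ → does⇔ (transition? Z P Z′)
      ; finalOK = does⇔ ∘ final?
      }

  record Extensional (A : SymDFA p) : Set where
    field
      S-resp : ∀ {Z Z′} → Z ≗ Z′ → S A Z ≡ S A Z′
      T-resp : ∀ {Z₁ Z₂} P {Z₁′ Z₂′} → Z₁ ≗ Z₂ → Z₁′ ≗ Z₂′ → T A Z₁ P Z₁′ ≡ T A Z₂ P Z₂′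
      F-resp : ∀ {Z Z′} → Z ≗ Z′ → F A Z ≡ F A Z′

  acceptsFrom-resp : ∀ {A} → Extensional A → ∀ w {Z Z′} → Z ≗ Z′ → acceptsFrom A Z w → acceptsFrom A Z′ w
  acceptsFrom-resp ext [] Z≗Z′ accepted = trans (sym (Extensional.F-resp ext Z≗Z′)) accepted
  acceptsFrom-resp ext (a ∷ w) Z≗Z′ (Z″ , t , accepted) =
    Z″ , trans (sym (Extensional.T-resp ext a Z≗Z′ λ _ → refl)) t , accepted

  module _ {D : DFA p} {A : SymDFA p} (rep : SymRep D A) where
    open SymRep rep

    represented-extensional : Extensional A
    represented-extensional = record
      { S-resp = λ Z≗Z′ → ⇔⇒≡ (⇔-trans (initOK _) (⇔-trans (≗-resp Z≗Z′) (⇔-sym (initOK _))))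
      ; T-resp = λ P Z₁≗Z₂ Z₁′≗Z₂′ → ⇔⇒≡ (⇔-trans (transOK _ P _) (⇔-trans
          (mk⇔ (λ (s , s′ , h , h′ , e) → s , s′ , to (≗-resp Z₁≗Z₂) h , to (≗-resp Z₁′≗Z₂′) h′ , e)
               (λ (s , s′ , h , h′ , e) → s , s′ , from (≗-resp Z₁≗Z₂) h , from (≗-resp Z₁′≗Z₂′) h′ , e))
          (⇔-sym (transOK _ P _))))
      ; F-resp = λ Z≗Z′ → ⇔⇒≡ (⇔-trans (finalOK _) (⇔-trans
          (mk⇔ (λ (s , h , e) → s , to (≗-resp Z≗Z′) h , e) (λ (s , h , e) → s , from (≗-resp Z≗Z′) h , e))
          (⇔-sym (finalOK _))))
      }

    private
      same-state : ∀ {Z s s′} → Z ≗ enc s → Z ≗ enc s′ → s ≡ s′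
      same-state Z≗s Z≗s′ = encInj _ _ λ i → trans (sym (Z≗s i)) (Z≗s′ i)

    acceptsFrom-represented : ∀ w s {Z} → Z ≗ enc s → acceptsFrom A Z w ⇔ (acceptsAt D s w ≡ true)
    acceptsFrom-represented [] s {Z} Z≗s = mk⇔
      (λ FZ → let (s′ , Z≗s′ , fin) = to (finalOK Z) FZ in
         subst (λ x → final D x ≡ true) (sym (same-state Z≗s Z≗s′)) fin)
      (λ fin → from (finalOK Z) (s , Z≗s , fin))
    acceptsFrom-represented (a ∷ w) s {Z} Z≗s = mk⇔
      (λ (Z′ , TZ , accepted) → let (s₁ , s₁′ , Z≗s₁ , Z′≗s₁′ , δs₁) = to (transOK Z a Z′) TZ in
         subst (λ x → acceptsAt D x w ≡ true)
               (trans (sym δs₁) (cong (λ x → δ D x a) (sym (same-state Z≗s Z≗s₁))))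
               (to (acceptsFrom-represented w s₁′ Z′≗s₁′) accepted))
      (λ accepted → enc (δ D s a) , from (transOK Z a _) (s , δ D s a , Z≗s , (λ _ → refl) , refl) ,
               from (acceptsFrom-represented w (δ D s a) λ _ → refl) accepted)

    represented-language : ∀ w → SymAccepts A w ⇔ (accepts D w ≡ true)
    represented-language w = mk⇔
      (λ (Z , SZ , accepted) → to (acceptsFrom-represented w (init D) (to (initOK Z) SZ)) accepted)
      (λ accepted → enc (init D) , from (initOK _) (λ _ → refl) ,
                    from (acceptsFrom-represented w (init D) λ _ → refl) accepted)

  module _ (A₁ A₂ : SymDFA p) where
    private
      m₁ = vars A₁
      m₂ = vars A₂

    left : Assignment (m₁ + m₂) → Assignment m₁
    left Z i = Z (i ↑ˡ m₂)

    right : Assignment (m₁ + m₂) → Assignment m₂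
    right Z i = Z (m₁ ↑ʳ i)

    join : Assignment m₁ → Assignment m₂ → Assignment (m₁ + m₂)
    join Z₁ Z₂ i = [ Z₁ , Z₂ ]′ (splitAt m₁ i)

    left-join : ∀ Z₁ Z₂ → left (join Z₁ Z₂) ≗ Z₁
    left-join Z₁ Z₂ i = cong [ Z₁ , Z₂ ]′ (splitAt-↑ˡ m₁ i m₂)

    right-join : ∀ Z₁ Z₂ → right (join Z₁ Z₂) ≗ Z₂
    right-join Z₁ Z₂ i = cong [ Z₁ , Z₂ ]′ (splitAt-↑ʳ m₁ m₂ i)

    module _ (ext₁ : Extensional A₁) (ext₂ : Extensional A₂) where
      open Extensional

      ∩ˢ-extensional : Extensional (A₁ ∩ˢ A₂)
      ∩ˢ-extensional = record
        { S-resp = λ Z≗Z′ → cong₂ _∧_ (S-resp ext₁ (Z≗Z′ ∘ _)) (S-resp ext₂ (Z≗Z′ ∘ _))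
        ; T-resp = λ P Z≗ Z′≗ →
            cong₂ _∧_ (T-resp ext₁ P (Z≗ ∘ _) (Z′≗ ∘ _)) (T-resp ext₂ P (Z≗ ∘ _) (Z′≗ ∘ _))
        ; F-resp = λ Z≗Z′ → cong₂ _∧_ (F-resp ext₁ (Z≗Z′ ∘ _)) (F-resp ext₂ (Z≗Z′ ∘ _))
        }

      acceptsFrom-join : ∀ w {Z₁ Z₂} → acceptsFrom A₁ Z₁ w → acceptsFrom A₂ Z₂ w →
        acceptsFrom (A₁ ∩ˢ A₂) (join Z₁ Z₂) w
      acceptsFrom-∩ˢ : ∀ w Z →
        acceptsFrom (A₁ ∩ˢ A₂) Z w ⇔ (acceptsFrom A₁ (left Z) w × acceptsFrom A₂ (right Z) w)

      acceptsFrom-join w {Z₁} {Z₂} acc₁ acc₂ = from (acceptsFrom-∩ˢ w (join Z₁ Z₂))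
        ( acceptsFrom-resp ext₁ w (sym ∘ left-join Z₁ Z₂) acc₁
        , acceptsFrom-resp ext₂ w (sym ∘ right-join Z₁ Z₂) acc₂)

      acceptsFrom-∩ˢ [] Z = ∧-≡-true
      acceptsFrom-∩ˢ (a ∷ w) Z = mk⇔
        (λ (Z′ , t , accepted) →
           let (acc₁ , acc₂) = to (acceptsFrom-∩ˢ w Z′) accepted ; (t₁ , t₂) = to ∧-≡-true t in
           (left Z′ , t₁ , acc₁) , (right Z′ , t₂ , acc₂))
        (λ ((Z₁ , t₁ , acc₁) , (Z₂ , t₂ , acc₂)) → join Z₁ Z₂ ,
           from ∧-≡-true ( trans (T-resp ext₁ a (λ _ → refl) (left-join Z₁ Z₂)) t₁
                         , trans (T-resp ext₂ a (λ _ → refl) (right-join Z₁ Z₂)) t₂) ,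
           acceptsFrom-join w acc₁ acc₂)

      ∩ˢ-language : ∀ w → SymAccepts (A₁ ∩ˢ A₂) w ⇔ (SymAccepts A₁ w × SymAccepts A₂ w)
      ∩ˢ-language w = mk⇔
        (λ (Z , s , accepted) →
           let (acc₁ , acc₂) = to (acceptsFrom-∩ˢ w Z) accepted ; (s₁ , s₂) = to ∧-≡-true s in
           (left Z , s₁ , acc₁) , (right Z , s₂ , acc₂))
        (λ ((Z₁ , s₁ , acc₁) , (Z₂ , s₂ , acc₂)) → join Z₁ Z₂ ,
           from ∧-≡-true ( trans (S-resp ext₁ (left-join Z₁ Z₂)) s₁
                         , trans (S-resp ext₂ (right-join Z₁ Z₂)) s₂) ,
           acceptsFrom-join w acc₁ acc₂)

module _ {A : Set} (key : A → ℕ) where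

  extract-min : ∀ x xs → ∃₂ λ m rest → (x ∷ xs ↭ m ∷ rest) × All (λ y → key m ≤ key y) rest
  extract-min x [] = x , [] , ↭-refl , []
  extract-min x (y ∷ ys) with extract-min y ys
  ... | m , rest , perm , m≤rest with key x ≤? key m
  ...   | yes x≤m = x , m ∷ rest , prep x perm , x≤m ∷ All.map (≤-trans x≤m) m≤rest
  ...   | no x≰m =
    m , x ∷ rest , ↭-trans (prep x perm) (swap x m ↭-refl) , ≰⇒≥ x≰m ∷ m≤rest

  extract-two-min : ∀ x y ys → Σ A λ m₁ → Σ A λ m₂ → Σ (List A) λ rest →
    (x ∷ y ∷ ys ↭ m₁ ∷ m₂ ∷ rest) × key m₁ ≤ key m₂ × All (λ z → key m₂ ≤ key z) rest
  extract-two-min x y ys with extract-min x (y ∷ ys)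
  ... | m₁ , [] , perm , _ = case ↭-length perm of λ ()
  ... | m₁ , z ∷ zs , perm₁ , m₁≤ with extract-min z zs
  ...   | m₂ , rest , perm₂ , m₂≤rest =
    m₁ , m₂ , rest , ↭-trans perm₁ (prep m₁ perm₂) , All.head (All-resp-↭ perm₂ m₁≤) , m₂≤rest

module _ {A : Set} {P : A → Set} where

  All-↭⇔ : ∀ {xs ys} → xs ↭ ys → All P xs ⇔ All P ys
  All-↭⇔ perm = mk⇔ (All-resp-↭ perm) (All-resp-↭ (↭-sym perm))

  All-[_]⇔ : ∀ x → All P (x ∷ []) ⇔ P x
  All-[ x ]⇔ = mk⇔ All.head (_∷ [])

  All-merge⇔ : ∀ {x y z xs} → P x ⇔ (P y × P z) → All P (x ∷ xs) ⇔ All P (y ∷ z ∷ xs)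
  All-merge⇔ x⇔y×z = mk⇔ (λ { (Px ∷ Pxs) → let (Py , Pz) = to x⇔y×z Px in Py ∷ Pz ∷ Pxs })
                          (λ { (Py ∷ Pz ∷ Pxs) → from x⇔y×z (Py , Pz) ∷ Pxs })

  Pointwise-All⇔ : ∀ {B : Set} {Q : B → Set} {R : B → A → Set} →
    (∀ {x y} → R x y → P y ⇔ Q x) → ∀ {xs ys} → Pointwise R xs ys → All P ys ⇔ All Q xs
  Pointwise-All⇔ R⇒⇔ [] = mk⇔ (λ _ → []) (λ _ → [])
  Pointwise-All⇔ R⇒⇔ (xRy ∷ rel) =
    mk⇔ (λ { (Py ∷ Pys) → to (R⇒⇔ xRy) Py ∷ to (Pointwise-All⇔ R⇒⇔ rel) Pys })
        (λ { (Qx ∷ Qxs) → from (R⇒⇔ xRy) Qx ∷ from (Pointwise-All⇔ R⇒⇔ rel) Qxs })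

module _ {p : ℕ} where

  Lang-∧ : ∀ {φ ψ : Formula p} {w} → Lang (φ `∧ ψ) w ⇔ (Lang φ w × Lang ψ w)
  Lang-∧ = mk⇔ (λ (nonempty , φw , ψw) → (nonempty , φw) , (nonempty , ψw))
               (λ ((nonempty , φw) , (_ , ψw)) → nonempty , φw , ψw)

  ⋀-language : ∀ (φs : List⁺ (Formula p)) w → Lang (⋀ φs) w ⇔ All (λ φ → Lang φ w) (List⁺.toList φs)
  ⋀-language (φ ∷ ψs) = conjAux-language φ ψs
    where
    conjAux-language : ∀ φ ψs w → Lang (conjAux φ ψs) w ⇔ All (λ φ → Lang φ w) (φ ∷ ψs)
    conjAux-language φ [] w = ⇔-sym All-[ φ ]⇔
    conjAux-language φ (ψ ∷ ψs) w = mk⇔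
      (λ (nonempty , φw , rest) → (nonempty , φw) ∷ to (conjAux-language ψ ψs w) (nonempty , rest))
      (λ { ((nonempty , φw) ∷ rest) → nonempty , φw , proj₂ (from (conjAux-language ψ ψs w) rest) })

  intersection-accepts : ∀ {D D₁ D₂ : DFA p} → RecognisesIntersection D D₁ D₂ →
    ∀ w → (accepts D w ≡ true) ⇔ ((accepts D₁ w ≡ true) × (accepts D₂ w ≡ true))
  intersection-accepts D≡D₁∩D₂ w = ⇔-trans (≡⇒≡-true⇔ (D≡D₁∩D₂ w)) ∧-≡-true

  ∧-recognised : ∀ {D D₁ D₂ : DFA p} {φ ψ} → RecognisesIntersection D D₁ D₂ →
    RecognisesFormula D₁ φ → RecognisesFormula D₂ ψ → RecognisesFormula D (φ `∧ ψ)
  ∧-recognised {D} {D₁} {D₂} D≡D₁∩D₂ D₁⊨φ D₂⊨ψ w =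
    ⇔-trans (intersection-accepts {D} {D₁} {D₂} D≡D₁∩D₂ w) (⇔-trans (D₁⊨φ w ×-⇔ D₂⊨ψ w) (⇔-sym Lang-∧))

  recognises-intersection : ∀ {D D₁ D₂ : DFA p} {φ ψ} → RecognisesFormula D (φ `∧ ψ) →
    RecognisesFormula D₁ φ → RecognisesFormula D₂ ψ → RecognisesIntersection D D₁ D₂
  recognises-intersection D⊨φ∧ψ D₁⊨φ D₂⊨ψ w =
    ⇔⇒≡ (⇔-trans (D⊨φ∧ψ w) (⇔-trans Lang-∧ (⇔-sym (⇔-trans ∧-≡-true (D₁⊨φ w ×-⇔ D₂⊨ψ w)))))

  initialCollection : ∀ (φs : List (Formula p)) →
    ∃ λ Ds → Pointwise (λ φ D → Minimal D × RecognisesFormula D φ) φs Ds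
  initialCollection [] = [] , []
  initialCollection (φ ∷ φs) with minimalDFA φ | initialCollection φs
  ... | D , D-minimal , D⊨φ | Ds , rel = D ∷ Ds , (D-minimal , D⊨φ) ∷ rel

module Lisa {p : ℕ} (t₁ t₂ : ℕ) (nodes : Nodes p) where

  _↝_ : Config p → Config p → Set
  _↝_ = Step t₁ t₂ nodes

  WellFormed : Config p → Set
  WellFormed (explicit Ds) = (Ds ≢ []) × All (λ D → ∃ (RecognisesFormula D)) Ds
  WellFormed (symbolic As) = (As ≢ []) × All Extensional As
  WellFormed (done _) = ⊤

  ConfigLanguage : Config p → Word p → Set
  ConfigLanguage (explicit Ds) w = All (λ D → accepts D w ≡ true) Ds
  ConfigLanguage (symbolic As) w = All (λ A → SymAccepts A w) As
  ConfigLanguage (done A) w = SymAccepts A w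

  step-wellFormed : ∀ {c c′} → c ↝ c′ → WellFormed c → WellFormed c′
  step-wellFormed (single _) _ = tt
  step-wellFormed (mergeContinue {D₁ = D₁} {D₂ = D₂} {D = D} perm _ _ _ _ _ D≡D₁∩D₂ _) (_ , formulas)
    with All-resp-↭ perm formulas
  ... | (φ , D₁⊨φ) ∷ (ψ , D₂⊨ψ) ∷ rest =
    (λ ()) , (φ `∧ ψ , ∧-recognised {D = D} {D₁} {D₂} D≡D₁∩D₂ D₁⊨φ D₂⊨ψ) ∷ rest
  step-wellFormed (mergeFinish _ _ _ _ _ _ _) _ = tt
  step-wellFormed (switch _ _ _ _ reps@(_ ∷ _)) _ = (λ ()) , represented-all reps
    where
    represented-all : ∀ {Ds As} → Pointwise SymRep Ds As → All Extensional As
    represented-all [] = []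
    represented-all (rep ∷ reps) = represented-extensional rep ∷ represented-all reps
  step-wellFormed (symMerge {A₁ = A₁} {A₂} perm _ _) (_ , exts) with All-resp-↭ perm exts
  ... | ext₁ ∷ ext₂ ∷ rest = (λ ()) , ∩ˢ-extensional A₁ A₂ ext₁ ext₂ ∷ rest
  step-wellFormed symFinish _ = tt

  step-language : ∀ {c c′} → c ↝ c′ → WellFormed c → ∀ w → ConfigLanguage c′ w ⇔ ConfigLanguage c w
  step-language (single {D} rep) _ w = ⇔-trans (represented-language rep w) (⇔-sym All-[ D ]⇔)
  step-language (mergeContinue {D₁ = D₁} {D₂ = D₂} {D = D} perm _ _ _ _ _ D≡D₁∩D₂ _) _ w =
    ⇔-trans (All-merge⇔ (intersection-accepts {D = D} {D₁} {D₂} D≡D₁∩D₂ w)) (⇔-sym (All-↭⇔ perm))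
  step-language (mergeFinish {D₁ = D₁} {D₂ = D₂} {D = D} perm _ _ _ _ D≡D₁∩D₂ rep) _ w =
    ⇔-trans (represented-language rep w) (⇔-trans (⇔-sym All-[ D ]⇔)
      (⇔-trans (All-merge⇔ (intersection-accepts {D = D} {D₁} {D₂} D≡D₁∩D₂ w)) (⇔-sym (All-↭⇔ perm))))
  step-language (switch perm _ _ _ reps) _ w =
    ⇔-trans (Pointwise-All⇔ (λ rep → represented-language rep w) reps) (⇔-sym (All-↭⇔ perm))
  step-language (symMerge {A₁ = A₁} {A₂} perm _ _) (_ , exts) w with All-resp-↭ perm exts
  ... | ext₁ ∷ ext₂ ∷ _ = ⇔-trans (All-merge⇔ (∩ˢ-language A₁ A₂ ext₁ ext₂ w)) (⇔-sym (All-↭⇔ perm))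
  step-language (symFinish {A}) _ w = ⇔-sym All-[ A ]⇔

  steps-wellFormed : ∀ {c c′} → Star _↝_ c c′ → WellFormed c → WellFormed c′
  steps-wellFormed ε wf = wf
  steps-wellFormed (s ◅ ss) wf = steps-wellFormed ss (step-wellFormed s wf)

  steps-language : ∀ {c c′} → Star _↝_ c c′ → WellFormed c → ∀ w → ConfigLanguage c′ w ⇔ ConfigLanguage c w
  steps-language ε _ w = ⇔-refl
  steps-language (s ◅ ss) wf w = ⇔-trans (steps-language ss (step-wellFormed s wf) w) (step-language s wf w)

  progress : ∀ c → WellFormed c → IsDone c ⊎ ∃ (c ↝_)
  progress (done _) _ = inj₁ tt
  progress (explicit []) (nonempty , _) = ⊥-elim (nonempty refl)
  progress (explicit (D ∷ [])) _ = inj₂ (_ , single (symbolicDFA-represents D))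
  progress (explicit (D ∷ E ∷ Es)) (_ , formulas) with extract-two-min states D E Es
  ... | D₁ , D₂ , rest , perm , D₁≤D₂ , D₂≤rest with All-resp-↭ perm formulas
  ...   | (φ , D₁⊨φ) ∷ (ψ , D₂⊨ψ) ∷ _ with states D₁ <? t₁ ×-dec states D₁ * states D₂ <? t₂
  ...     | no ¬small = inj₂ (_ , switch perm D₁≤D₂ D₂≤rest ¬small (represent-all (D₁ ∷ D₂ ∷ rest)))
    where
    represent-all : ∀ Ds → Pointwise SymRep Ds (List.map symbolicDFA Ds)
    represent-all [] = []
    represent-all (D ∷ Ds) = symbolicDFA-represents D ∷ represent-all Ds
  ...     | yes (small₁ , small₂) with minimalDFA (φ `∧ ψ)
  ...       | M , M-minimal , M⊨φ∧ψ = merge rest perm D₂≤rest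
    where
    M≡D₁∩D₂ : RecognisesIntersection M D₁ D₂
    M≡D₁∩D₂ = recognises-intersection {D = M} {D₁} {D₂} M⊨φ∧ψ D₁⊨φ D₂⊨ψ
    merge : ∀ rest → D ∷ E ∷ Es ↭ D₁ ∷ D₂ ∷ rest → All (λ F → states D₂ ≤ states F) rest →
            IsDone (explicit (D ∷ E ∷ Es)) ⊎ ∃ (explicit (D ∷ E ∷ Es) ↝_)
    merge [] perm _ =
      inj₂ (_ , mergeFinish perm D₁≤D₂ small₁ small₂ M-minimal M≡D₁∩D₂ (symbolicDFA-represents M))
    merge (F ∷ Fs) perm D₂≤rest =
      inj₂ (explicit (M ∷ F ∷ Fs) , mergeContinue perm D₁≤D₂ D₂≤rest small₁ small₂ M-minimal M≡D₁∩D₂ λ ())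
  progress (symbolic []) (nonempty , _) = ⊥-elim (nonempty refl)
  progress (symbolic (A ∷ [])) _ = inj₂ (_ , symFinish)
  progress (symbolic (A ∷ B ∷ Bs)) _ with extract-two-min (cost nodes) A B Bs
  ... | A₁ , A₂ , rest , perm , A₁≤A₂ , A₂≤rest = inj₂ (_ , symMerge perm A₁≤A₂ A₂≤rest)

  -- Switching to symbolic form keeps the number of automata, so explicit ones count twice.
  rank : Config p → ℕ
  rank (explicit Ds) = length Ds + length Ds
  rank (symbolic As) = length As
  rank (done _) = 0

  step-decreasing : ∀ {c c′} → c ↝ c′ → rank c′ < rank c
  step-decreasing (single _) = s≤s z≤n
  step-decreasing (mergeContinue {rest = rest} perm _ _ _ _ _ _ _) rewrite ↭-length perm =
    +-mono-< (n<1+n (suc (length rest))) (n<1+n (suc (length rest)))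
  step-decreasing (mergeFinish perm _ _ _ _ _ _) rewrite ↭-length perm = s≤s z≤n
  step-decreasing (switch {Ds} {D₁} {D₂} {rest} {As} perm _ _ _ reps) = begin-strict
    length As                    ≡⟨ Pointwise-length reps ⟨
    length Ds′                   <⟨ m<m+n (length Ds′) (s≤s z≤n) ⟩
    length Ds′ + length Ds′      ≡⟨ cong₂ _+_ (↭-length perm) (↭-length perm) ⟨
    length Ds + length Ds        ∎
    where
    open ≤-Reasoning
    Ds′ = D₁ ∷ D₂ ∷ rest
  step-decreasing (symMerge perm _ _) rewrite ↭-length perm = ≤-refl
  step-decreasing symFinish = s≤s z≤n

  terminating : ∀ c → Acc (λ c′ c → c ↝ c′) c
  terminating = Subrelation.wellFounded step-decreasing (On.wellFounded rank <-wellFounded)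

  initial-wellFormed : ∀ {φs Ds} → InitialCollection φs Ds → WellFormed (explicit Ds)
  initial-wellFormed rel@(_ ∷ _) = (λ ()) , recognised-all rel
    where
    recognised-all : ∀ {ψs Es} → Pointwise (λ φ D → Minimal D × RecognisesFormula D φ) ψs Es →
                     All (λ D → ∃ (RecognisesFormula D)) Es
    recognised-all [] = []
    recognised-all ((_ , D⊨φ) ∷ rel) = (_ , D⊨φ) ∷ recognised-all rel

  initial-language : ∀ {φs Ds} → InitialCollection φs Ds →
    ∀ w → ConfigLanguage (explicit Ds) w ⇔ Lang (⋀ φs) w
  initial-language {φs} initial w =
    ⇔-trans (Pointwise-All⇔ (λ (_ , D⊨φ) → D⊨φ w) initial) (⇔-sym (⋀-language φs w))

theorem1 : (p t₁ t₂ : ℕ) → 0 < t₁ → 0 < t₂ → (nodes : Nodes p) →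
    (φs : List⁺ (Formula p)) →
    (Σ (List (DFA p)) λ Ds → InitialCollection φs Ds) ×
    (∀ (Ds : List (DFA p)) → InitialCollection φs Ds →
      Acc (λ c' c → Step t₁ t₂ nodes c c') (explicit Ds) ×
      (∀ c → Star (Step t₁ t₂ nodes) (explicit Ds) c →
         IsDone c ⊎ ∃ (Step t₁ t₂ nodes c)) ×
      (∀ A → Star (Step t₁ t₂ nodes) (explicit Ds) (done A) →
         ∀ w → SymAccepts A w ⇔ Lang (⋀ φs) w))
theorem1 p t₁ t₂ _ _ nodes φs =
  initialCollection (List⁺.toList φs) ,
  λ Ds initial →
    terminating (explicit Ds) ,
    (λ c steps → progress c (steps-wellFormed steps (initial-wellFormed initial))) ,
    λ A steps w → ⇔-trans (steps-language steps (initial-wellFormed initial) w) (initial-language initial w)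
  where open Lisa t₁ t₂ nodes
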